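{- Let $S$ be a finite non-empty set of positive integers and let $k = \max S$. Let $(a_n)_{n\ge1}$ be the $S$-LID sequence. Then for all integers $n \ge k+1$, \[ a_{n+1} \ \ge\ a_n + a_{n-k}. \]
   Context: For a set $S$ of positive integers, the $S$-legal index difference ($S$-LID) sequence $(a_n)_{n\ge 1}$ is defined recursively: for each positive integer $n$, $a_n$ is the smallest positive integer that cannot be written as $\sum_{\ell\in L} a_\ell$ for some set $L \subseteq \{1,\dots,n-1\}$ such that $|i-j|\notin S$ for all $i,j\in L$ (the empty sum is $0$). -}

module Defs where

open import Data.Nat using (ℕ; _≤_; _<_; ∣_-_∣)
open import Data.List using (List; map)
open import Data.Nat.ListAction using (sum)
open import Data.List.Membership.Propositional using (_∈_; _∉_)
open import Data.List.Relation.Unary.All using (All)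
open import Data.List.Relation.Unary.Unique.Propositional using (Unique)
open import Data.Product using (Σ; _×_)
open import Relation.Binary.PropositionalEquality using (_≡_)
open import Relation.Nullary using (¬_)

-- Sequences are functions a : ℕ → ℕ indexed from 1 (the value a 0 is irrelevant).
-- A finite set S of positive integers is given as a list of naturals.

Legal : List ℕ → ℕ → List ℕ → Set
Legal S n L =
  Unique L ×
  All (λ i → 1 ≤ i × i < n) L ×
  (∀ i j → i ∈ L → j ∈ L → ∣ i - j ∣ ∉ S)

Representable : List ℕ → (ℕ → ℕ) → ℕ → ℕ → Set
Representable S a n m = Σ (List ℕ) (λ L → Legal S n L × sum (map a L) ≡ m)

IsLID : List ℕ → (ℕ → ℕ) → Set
IsLID S a = ∀ n → 1 ≤ n →
  1 ≤ a n ×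
  ¬ Representable S a n (a n) ×
  (∀ m → 1 ≤ m → m < a n → Representable S a n m)

{-# OPTIONS --safe #-}
module Submission where

-- If a_{n+1} < a_n + a_{n-k}, then a_{n+1} is already a legal sum of earlier
-- terms: either a_{n+1} < a_n, and minimality of a_n represents it by indices
-- below n; or a_{n+1} - a_n < a_{n-k}, and minimality of a_{n-k} represents the
-- difference by indices below n - k, all more than k = max S away from n, so n
-- can be added to that index set. Both contradict the choice of a_{n+1}.

open import Defs
open import Data.Nat using (ℕ; _≤_; _<_; _+_; _∸_; suc; z<s; ∣_-_∣)
open import Data.Nat.Properties
open import Data.List using (List; []; _∷_)
open import Data.List.Membership.Propositional using (_∈_; _∉_)
open import Data.List.Relation.Unary.All as All using (All; []; _∷_)
open import Data.List.Relation.Unary.Any using (here; there)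
open import Data.List.Relation.Unary.AllPairs using ([]; _∷_)
open import Data.Product using (_,_; proj₁; proj₂)
open import Relation.Binary.PropositionalEquality using (refl; sym; cong; subst; subst₂)
open import Relation.Nullary using (yes; no)
open import Function using (_∘_)

private
  variable
    S L : List ℕ
    a : ℕ → ℕ
    k m n n′ : ℕ

positive⇒0∉ : All (1 ≤_) S → 0 ∉ S
positive⇒0∉ pos 0∈S with All.lookup pos 0∈S
... | ()

Legal-mono : n ≤ n′ → Legal S n L → Legal S n′ L
Legal-mono n≤n′ (unique , bounds , apart) =
  unique , All.map (λ (1≤i , i<n) → 1≤i , <-≤-trans i<n n≤n′) bounds , apart

Representable-mono : n ≤ n′ → Representable S a n m → Representable S a n′ m
Representable-mono n≤n′ (L , legal , sum≡m) = L , Legal-mono n≤n′ legal , sum≡m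

Legal-∷ : 0 ∉ S → 1 ≤ n → (∀ j → j ∈ L → ∣ n - j ∣ ∉ S) →
          Legal S n L → Legal S (suc n) (n ∷ L)
Legal-∷ {S} {n} {L} 0∉S 1≤n n-apart (unique , bounds , apart) =
  All.map (λ (_ , j<n) n≡j → <-irrefl (sym n≡j) j<n) bounds ∷ unique ,
  (1≤n , ≤-refl) ∷ All.map (λ (1≤j , j<n) → 1≤j , m≤n⇒m≤1+n j<n) bounds ,
  apart′
  where
  apart′ : ∀ i j → i ∈ n ∷ L → j ∈ n ∷ L → ∣ i - j ∣ ∉ S
  apart′ _ _ (here refl) (here refl) = 0∉S ∘ subst (_∈ S) (∣n-n∣≡0 n)
  apart′ _ j (here refl) (there j∈L) = n-apart j j∈L
  apart′ i _ (there i∈L) (here refl) = n-apart i i∈L ∘ subst (_∈ S) (∣-∣-comm i n)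
  apart′ i j (there i∈L) (there j∈L) = apart i j i∈L j∈L

∣-∣∉-bounded : All (_≤ k) S → k ≤ n → ∀ {j} → j < n ∸ k → ∣ n - j ∣ ∉ S
∣-∣∉-bounded {k = k} {n = n} bounded k≤n {j} j<n∸k ∣n-j∣∈S =
  <⇒≱ k<∣n-j∣ (All.lookup bounded ∣n-j∣∈S)
  where
  k<∣n-j∣ : k < ∣ n - j ∣
  k<∣n-j∣ = subst₂ _<_ (m∸[m∸n]≡n k≤n) (sym (m≤n⇒∣n-m∣≡n∸m j≤n))
                       (∸-monoʳ-< j<n∸k (m∸n≤m n k))
    where
    j≤n : j ≤ n
    j≤n = ≤-trans (<⇒≤ j<n∸k) (m∸n≤m n k)

Representable-∷ : All (1 ≤_) S → All (_≤ k) S → k ≤ n → 1 ≤ n →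
                  Representable S a (n ∸ k) m → Representable S a (suc n) (a n + m)
Representable-∷ {k = k} {n = n} {a = a} pos bounded k≤n 1≤n (L , legal , sum≡m) =
  n ∷ L ,
  Legal-∷ (positive⇒0∉ pos) 1≤n
    (λ _ j∈L → ∣-∣∉-bounded bounded k≤n (proj₂ (All.lookup (proj₁ (proj₂ legal)) j∈L)))
    (Legal-mono (m∸n≤m n k) legal) ,
  cong (a n +_) sum≡m

IsLID⇒Representable-< : IsLID S a → 1 ≤ n → m < a n → Representable S a n m
IsLID⇒Representable-< {m = 0}     _   _   _    = [] , ([] , [] , λ _ _ ()) , refl
IsLID⇒Representable-< {m = suc m} lid 1≤n m<aₙ = proj₂ (proj₂ (lid _ 1≤n)) (suc m) z<s m<aₙ

IsLID⇒Representable-<+ : All (1 ≤_) S → All (_≤ k) S → IsLID S a → k < n →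
                          m < a n + a (n ∸ k) → Representable S a (suc n) m
IsLID⇒Representable-<+ {S = S} {k = k} {a = a} {n = n} {m = m} pos bounded lid k<n m<
  with m <? a n
... | yes m<aₙ =
  Representable-mono (n≤1+n n) (IsLID⇒Representable-< lid (<-≤-trans z<s k<n) m<aₙ)
... | no m≮aₙ =
  subst (Representable S a (suc n)) (m+[n∸m]≡n aₙ≤m)
    (Representable-∷ pos bounded (<⇒≤ k<n) (<-≤-trans z<s k<n)
      (IsLID⇒Representable-< lid (m<n⇒0<n∸m k<n)
        (+-cancelˡ-< (a n) (m ∸ a n) (a (n ∸ k))
          (subst (_< a n + a (n ∸ k)) (sym (m+[n∸m]≡n aₙ≤m)) m<))))
  where
  aₙ≤m : a n ≤ m
  aₙ≤m = ≮⇒≥ m≮aₙ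

proposition1p11 : (S : List ℕ) → All (λ s → 1 ≤ s) S →
    (k : ℕ) → k ∈ S → All (λ s → s ≤ k) S →
    (a : ℕ → ℕ) → IsLID S a →
    (n : ℕ) → suc k ≤ n → a n + a (n ∸ k) ≤ a (suc n)
proposition1p11 S pos k _ bounded a lid n k<n =
  ≮⇒≥ λ aₙ₊₁< → proj₁ (proj₂ (lid (suc n) z<s))
                  (IsLID⇒Representable-<+ pos bounded lid k<n aₙ₊₁<)
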